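{- Let $N \unlhd \mathrm{GL}_2(\mathbb{Z}_3)$ be a closed normal subgroup such that the subgroup generated by $\mathrm{SL}_2(\mathbb{Z}_3)$ and $N$ equals $\mathrm{GL}_2(\mathbb{Z}_3)$. Then $N = \mathrm{GL}_2(\mathbb{Z}_3)$. -}

module Defs where

open import Data.Nat using (ℕ; zero; suc; _+_; _*_; _∸_; _^_; NonZero)
open import Data.Nat.DivMod using (_/_; _mod_)
open import Data.Nat.Properties using (m^n≢0)
open import Data.Fin using (Fin; toℕ)
open import Data.Product using (Σ; _×_; ∃)
open import Relation.Binary.PropositionalEquality using (_≡_)

-- The ring ℤ₃ of 3-adic integers, represented by their 3-adic digit
-- expansions: a = Σ_i a(i) 3^i.  Equality is digitwise (extensional).

ℤ₃ : Set
ℤ₃ = ℕ → Fin 3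

infix 4 _≈_
_≈_ : ℤ₃ → ℤ₃ → Set
a ≈ b = ∀ i → a i ≡ b i

-- a ≡ b (mod 3^n): the first n digits agree
_≈[_]_ : ℤ₃ → ℕ → ℤ₃ → Set
a ≈[ n ] b = ∀ i → suc i Data.Nat.≤ n → a i ≡ b i

-- value of the truncation a mod 3^n, as a natural number < 3^n
val : ℤ₃ → ℕ → ℕ
val a zero    = zero
val a (suc n) = val a n + toℕ (a n) * 3 ^ n

digit : ℕ → ℕ → Fin 3
digit m n = (_/_ m (3 ^ n) {{m^n≢0 3 n}}) mod 3

-- ring operations: digit n of the result only depends on the
-- digits 0..n of the arguments
infixl 6 _+₃_ _-₃_
infixl 7 _*₃_

_+₃_ : ℤ₃ → ℤ₃ → ℤ₃
(a +₃ b) n = digit (val a (suc n) + val b (suc n)) n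

_*₃_ : ℤ₃ → ℤ₃ → ℤ₃
(a *₃ b) n = digit (val a (suc n) * val b (suc n)) n

-₃_ : ℤ₃ → ℤ₃
(-₃ a) n = digit (3 ^ suc n ∸ val a (suc n)) n

_-₃_ : ℤ₃ → ℤ₃ → ℤ₃
a -₃ b = a +₃ (-₃ b)

0₃ : ℤ₃
0₃ _ = Fin.zero

1₃ : ℤ₃
1₃ zero    = Fin.suc Fin.zero
1₃ (suc _) = Fin.zero

IsUnit : ℤ₃ → Set
IsUnit a = ∃ λ b → (a *₃ b) ≈ 1₃

record Mat : Set where
  constructor mat
  field
    a b c d : ℤ₃
open Mat public

infix 4 _≈M_
_≈M_ : Mat → Mat → Set
M ≈M M' = (a M ≈ a M') × (b M ≈ b M') × (c M ≈ c M') × (d M ≈ d M')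

-- entrywise congruence mod 3^n (basic neighbourhoods of the 3-adic topology)
_≈M[_]_ : Mat → ℕ → Mat → Set
M ≈M[ n ] M' = (a M ≈[ n ] a M') × (b M ≈[ n ] b M')
             × (c M ≈[ n ] c M') × (d M ≈[ n ] d M')

infixl 7 _·_
_·_ : Mat → Mat → Mat
M · M' = mat (a M *₃ a M' +₃ b M *₃ c M') (a M *₃ b M' +₃ b M *₃ d M')
             (c M *₃ a M' +₃ d M *₃ c M') (c M *₃ b M' +₃ d M *₃ d M')

I₂ : Mat
I₂ = mat 1₃ 0₃ 0₃ 1₃

det : Mat → ℤ₃
det M = a M *₃ d M -₃ b M *₃ c M

IsGL₂ : Mat → Set
IsGL₂ M = IsUnit (det M)

IsSL₂ : Mat → Set
IsSL₂ M = det M ≈ 1₃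

_InverseOf_ : Mat → Mat → Set
h InverseOf g = (g · h ≈M I₂) × (h · g ≈M I₂)

record IsSubgroup (H : Mat → Set) : Set where
  field
    respects : ∀ {g h} → g ≈M h → H g → H h
    ⊆GL₂     : ∀ {g} → H g → IsGL₂ g
    has-I    : H I₂
    mul      : ∀ {g h} → H g → H h → H (g · h)
    inv      : ∀ {g h} → H g → h InverseOf g → H h

record IsNormalSubgroup (H : Mat → Set) : Set where
  field
    subgroup : IsSubgroup H
    conj     : ∀ {g g⁻¹ h} → IsGL₂ g → g⁻¹ InverseOf g → H h → H (g · h · g⁻¹)

-- closed in the 3-adic (profinite) topology of GL₂(ℤ₃):
-- H contains every element of GL₂(ℤ₃) lying in its closure
IsClosed : (Mat → Set) → Set
IsClosed H = ∀ g → IsGL₂ g → (∀ n → ∃ λ h → H h × (h ≈M[ n ] g)) → H g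

data ⟨SL₂∪_⟩ (N : Mat → Set) : Mat → Set where
  gen-SL : ∀ {g} → IsSL₂ g → ⟨SL₂∪ N ⟩ g
  gen-N  : ∀ {g} → N g → ⟨SL₂∪ N ⟩ g
  gen-I  : ⟨SL₂∪ N ⟩ I₂
  gen-mul : ∀ {g h} → ⟨SL₂∪ N ⟩ g → ⟨SL₂∪ N ⟩ h → ⟨SL₂∪ N ⟩ (g · h)
  gen-inv : ∀ {g h} → ⟨SL₂∪ N ⟩ g → h InverseOf g → ⟨SL₂∪ N ⟩ h
  gen-resp : ∀ {g h} → g ≈M h → ⟨SL₂∪ N ⟩ g → ⟨SL₂∪ N ⟩ h

{-# OPTIONS --safe #-}
module Submission where

-- Since det maps ⟨SL₂ ∪ N⟩ into det N, the normal subgroup N contains an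
-- element of determinant -1.  After conjugating it so that e₁ becomes a cyclic
-- vector, it is the companion matrix C of some X² - τX - 1, so C ∈ N.  Modulo N
-- the conjugate C E(x) C⁻¹ = F(x) equals E(x), and conjugating E(x) ≡ F(x) by
-- diag(2, 1) gives E(x) ≡ E(4x); hence E(3x) ∈ N.  The Weyl element
-- E(1) F(-1) E(1) ≡ E(1) has order 4, so E(4) ∈ N and therefore E(1) ∈ N.
-- Conjugation by diag(u, 1) puts E(u) in N for every unit u, and every t is a
-- unit or 1 plus a unit, so all E(t) and F(t) lie in N.  These generate SL₂(ℤ₃),
-- so N ⊇ SL₂(ℤ₃) and N = ⟨SL₂ ∪ N⟩ = GL₂(ℤ₃).

open import Defs

open import Algebra.Bundles using (CommutativeRing)
open import Data.Fin using (Fin; toℕ)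
open import Data.Fin.Patterns using (0F; 1F; 2F)
import Data.Fin.Properties as Finₚ
open import Data.Fin.Properties using (all?; any?)
open import Data.Nat using (ℕ; zero; suc; _+_; _*_; _∸_; _^_; NonZero; _≤_; _<_; z≤n; s≤s; s≤s⁻¹)
import Data.Nat.Properties as ℕₚ
open import Data.Nat.DivMod using (_%_; _/_; _mod_)
open import Data.Product using (Σ; _×_; _,_; ∃; proj₁; proj₂)
open import Data.Sum using (_⊎_; inj₁; inj₂; [_,_]′)
open import Function using (_∘_)
open import Relation.Binary.Bundles using (Setoid)
open import Relation.Binary.PropositionalEquality as ≡ using (_≡_; refl; cong; cong₂)
import Relation.Binary.Reasoning.Setoid
open import Relation.Nullary using (¬_)
open import Relation.Nullary.Decidable using (toWitness; ¬?; _→-dec_; _⊎-dec_)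

module ModularArithmetic {d : ℕ} .{{_ : NonZero d}} where
  open ℕₚ
  open import Data.Nat.DivMod
  open ≡ using (sym; trans)

  [m%d+n]%d≡[m+n]%d : ∀ m n → (m % d + n) % d ≡ (m + n) % d
  [m%d+n]%d≡[m+n]%d m n = trans (%-distribˡ-+ (m % d) n d)
    (trans (cong (λ z → (z + n % d) % d) (m%n%n≡m%n m d)) (sym (%-distribˡ-+ m n d)))

  [m+n%d]%d≡[m+n]%d : ∀ m n → (m + n % d) % d ≡ (m + n) % d
  [m+n%d]%d≡[m+n]%d m n = trans (cong (_% d) (+-comm m (n % d)))
    (trans ([m%d+n]%d≡[m+n]%d n m) (cong (_% d) (+-comm n m)))

  [m%d*n]%d≡[m*n]%d : ∀ m n → (m % d * n) % d ≡ (m * n) % d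
  [m%d*n]%d≡[m*n]%d m n = trans (%-distribˡ-* (m % d) n d)
    (trans (cong (λ z → (z * (n % d)) % d) (m%n%n≡m%n m d)) (sym (%-distribˡ-* m n d)))

  [m*n%d]%d≡[m*n]%d : ∀ m n → (m * (n % d)) % d ≡ (m * n) % d
  [m*n%d]%d≡[m*n]%d m n = trans (cong (_% d) (*-comm m (n % d)))
    (trans ([m%d*n]%d≡[m*n]%d n m) (cong (_% d) (*-comm n m)))

  [[m+n]%d+[d∸n%d]]%d≡m : ∀ m n → m < d → ((m + n) % d + (d ∸ n % d)) % d ≡ m
  [[m+n]%d+[d∸n%d]]%d≡m m n m<d = begin
    ((m + n) % d + (d ∸ n % d)) % d  ≡⟨ [m%d+n]%d≡[m+n]%d (m + n) _ ⟩
    (m + n + (d ∸ n % d)) % d        ≡⟨ cong (_% d) (+-assoc m n _) ⟩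
    (m + (n + (d ∸ n % d))) % d      ≡⟨ [m+n%d]%d≡[m+n]%d m _ ⟨
    (m + (n + (d ∸ n % d)) % d) % d  ≡⟨ cong (λ z → (m + z) % d) ([m%d+n]%d≡[m+n]%d n _) ⟨
    (m + (n % d + (d ∸ n % d)) % d) % d ≡⟨ cong (λ z → (m + z % d) % d) (m+[n∸m]≡n (m%n≤n n d)) ⟩
    (m + d % d) % d                  ≡⟨ [m+n%d]%d≡[m+n]%d m d ⟩
    (m + d) % d                      ≡⟨ [m+n]%n≡m%n m d ⟩
    m % d                            ≡⟨ m<n⇒m%n≡m m<d ⟩
    m                                ∎
    where open ≡.≡-Reasoning

  +-cancelʳ-% : ∀ {m n} o → m < d → n < d → (m + o) % d ≡ (n + o) % d → m ≡ n
  +-cancelʳ-% {m} {n} o m<d n<d eq = begin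
    m                                ≡⟨ [[m+n]%d+[d∸n%d]]%d≡m m o m<d ⟨
    ((m + o) % d + (d ∸ o % d)) % d  ≡⟨ cong (λ z → (z + (d ∸ o % d)) % d) eq ⟩
    ((n + o) % d + (d ∸ o % d)) % d  ≡⟨ [[m+n]%d+[d∸n%d]]%d≡m n o n<d ⟩
    n                                ∎
    where open ≡.≡-Reasoning

3^n≢0 : ∀ n → NonZero (3 ^ n)
3^n≢0 n = ℕₚ.m^n≢0 3 n

-- instance search cannot find NonZero (3 ^ n) for a variable n
infixl 7 _%3^_ _/3^_
_%3^_ _/3^_ : ℕ → ℕ → ℕ
m %3^ n = _%_ m (3 ^ n) {{3^n≢0 n}}
m /3^ n = _/_ m (3 ^ n) {{3^n≢0 n}}

module Mod3^ (n : ℕ) = ModularArithmetic {3 ^ n} {{3^n≢0 n}}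

module ℤ₃Ring where
  open ℕₚ
  open import Data.Nat.DivMod hiding (_%_; _/_; _mod_)
  open import Data.Nat.Divisibility using (_∣_; ∣-refl; ∣-trans; n∣m*n; n∣m⇒m%n≡0)
  open import Data.Nat.Base using (_≤′_; ≤′-reflexive; ≤′-step)
  open ≡ using (sym; trans)
  open ≡.≡-Reasoning

  3^m∣3^n : ∀ {m n} → m ≤′ n → 3 ^ m ∣ 3 ^ n
  3^m∣3^n (≤′-reflexive refl) = ∣-refl
  3^m∣3^n (≤′-step m≤′n)      = ∣-trans (3^m∣3^n m≤′n) (n∣m*n 3)

  toℕ-digit : ∀ m i → toℕ (digit m i) ≡ m %3^ suc i /3^ i
  toℕ-digit m i = trans (Finₚ.toℕ-fromℕ< (m%n<n (m /3^ i) 3))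
    (sym (m%[n*o]/o≡m/o%n m 3 (3 ^ i) {{_}} {{3^n≢0 i}} {{3^n≢0 (suc i)}}))

  digit-cong : ∀ {m n} i → m %3^ suc i ≡ n %3^ suc i → digit m i ≡ digit n i
  digit-cong {m} {n} i eq = Finₚ.toℕ-injective
    (trans (toℕ-digit m i) (trans (cong (_/3^ i) eq) (sym (toℕ-digit n i))))

  val<3^n : ∀ x n → val x n < 3 ^ n
  val<3^n x zero    = s≤s z≤n
  val<3^n x (suc n) = +-mono-≤ (val<3^n x n) (*-monoˡ-≤ (3 ^ n) (s≤s⁻¹ (Finₚ.toℕ<n (x n))))

  val-digit : ∀ m n → val (digit m) n ≡ m %3^ n
  val-digit m zero    = sym (n%1≡0 m)
  val-digit m (suc n) = begin
    val (digit m) n + toℕ (digit m n) * 3 ^ n  ≡⟨ cong₂ _+_ (val-digit m n) (cong (_* 3 ^ n) (toℕ-digit m n)) ⟩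
    m %3^ n + r /3^ n * 3 ^ n                   ≡⟨ cong (_+ r /3^ n * 3 ^ n) r%3^n≡m%3^n ⟨
    r %3^ n + r /3^ n * 3 ^ n                   ≡⟨ m≡m%n+[m/n]*n r (3 ^ n) {{3^n≢0 n}} ⟨
    r                                           ∎
    where
    r : ℕ
    r = m %3^ suc n
    r%3^n≡m%3^n : r %3^ n ≡ m %3^ n
    r%3^n≡m%3^n = m∣n⇒o%n%m≡o%m (3 ^ n) (3 ^ suc n) m {{3^n≢0 n}} {{3^n≢0 (suc n)}} (n∣m*n 3)

  val-cong-≈[] : ∀ {x y} n → x ≈[ n ] y → val x n ≡ val y n
  val-cong-≈[] zero    x≈y = refl
  val-cong-≈[] (suc n) x≈y = cong₂ _+_ (val-cong-≈[] n (λ i i<n → x≈y i (m≤n⇒m≤1+n i<n)))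
                                      (cong (λ t → toℕ t * 3 ^ n) (x≈y n ≤-refl))

  val-cong : ∀ {x y} → x ≈ y → ∀ n → val x n ≡ val y n
  val-cong x≈y n = val-cong-≈[] n (λ i _ → x≈y i)

  val-mod : ∀ x {k n} → k ≤ n → val x n %3^ k ≡ val x k
  val-mod x k≤n = go (≤⇒≤′ k≤n)
    where
    go : ∀ {k n} → k ≤′ n → val x n %3^ k ≡ val x k
    go {k} (≤′-reflexive refl) = m<n⇒m%n≡m {{3^n≢0 k}} (val<3^n x k)
    go {k} {suc n} (≤′-step k≤′n) = trans
      (%-remove-+ʳ (val x n) {{3^n≢0 k}} (∣-trans (3^m∣3^n k≤′n) (n∣m*n (toℕ (x n)))))
      (go k≤′n)

  val-injective : ∀ {x y} → (∀ n → val x n ≡ val y n) → x ≈ y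
  val-injective {x} {y} eq i = Finₚ.toℕ-injective
    (*-cancelʳ-≡ (toℕ (x i)) (toℕ (y i)) (3 ^ i) {{3^n≢0 i}}
      (+-cancelˡ-≡ (val x i) _ _ (trans (eq (suc i)) (cong (_+ toℕ (y i) * 3 ^ i) (sym (eq i))))))

  val-digitwise : (f : ℕ → ℕ → ℕ) →
    (∀ m n k → f m n %3^ k ≡ f (m %3^ k) (n %3^ k) %3^ k) →
    ∀ x y n → val (λ i → digit (f (val x (suc i)) (val y (suc i))) i) n ≡ f (val x n) (val y n) %3^ n
  val-digitwise f f-mod x y n =
    trans (val-cong-≈[] n (λ i i<n → digit-cong i (truncate i i<n))) (val-digit (f (val x n) (val y n)) n)
    where
    truncate : ∀ i → i < n → f (val x (suc i)) (val y (suc i)) %3^ suc i ≡ f (val x n) (val y n) %3^ suc i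
    truncate i i<n = sym (trans (f-mod (val x n) (val y n) (suc i))
                               (cong₂ (λ p q → f p q %3^ suc i) (val-mod x i<n) (val-mod y i<n)))

  val-+ : ∀ x y n → val (x +₃ y) n ≡ (val x n + val y n) %3^ n
  val-+ = val-digitwise _+_ λ m n k →
    sym (trans (Mod3^.[m%d+n]%d≡[m+n]%d k m (n %3^ k)) (Mod3^.[m+n%d]%d≡[m+n]%d k m n))

  val-* : ∀ x y n → val (x *₃ y) n ≡ (val x n * val y n) %3^ n
  val-* = val-digitwise _*_ λ m n k →
    sym (trans (Mod3^.[m%d*n]%d≡[m*n]%d k m (n %3^ k)) (Mod3^.[m*n%d]%d≡[m*n]%d k m n))

  -- modulo 3 ^ (i + 1) both truncations are the residue cancelling val x (i + 1)
  val-neg : ∀ x n → val (-₃ x) n ≡ (3 ^ n ∸ val x n) %3^ n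
  val-neg x n = trans (val-cong-≈[] n (λ i i<n → digit-cong i (truncate i i<n))) (val-digit (3 ^ n ∸ val x n) n)
    where
    truncate : ∀ i → i < n → (3 ^ suc i ∸ val x (suc i)) %3^ suc i ≡ (3 ^ n ∸ val x n) %3^ suc i
    truncate i i<n = Mod3^.+-cancelʳ-% (suc i) (val x (suc i))
      (m%n<n _ (3 ^ suc i) {{3^n≢0 (suc i)}}) (m%n<n _ (3 ^ suc i) {{3^n≢0 (suc i)}})
      (trans cancel-suc-i (sym cancel-n))
      where
      k : ℕ
      k = suc i
      cancel-suc-i : ((3 ^ k ∸ val x k) %3^ k + val x k) %3^ k ≡ 0
      cancel-suc-i = begin
        ((3 ^ k ∸ val x k) %3^ k + val x k) %3^ k ≡⟨ Mod3^.[m%d+n]%d≡[m+n]%d k (3 ^ k ∸ val x k) _ ⟩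
        (3 ^ k ∸ val x k + val x k) %3^ k          ≡⟨ cong (_%3^ k) (m∸n+n≡m (<⇒≤ (val<3^n x k))) ⟩
        3 ^ k %3^ k                                ≡⟨ n%n≡0 (3 ^ k) {{3^n≢0 k}} ⟩
        0                                          ∎
      cancel-n : ((3 ^ n ∸ val x n) %3^ k + val x k) %3^ k ≡ 0
      cancel-n = begin
        ((3 ^ n ∸ val x n) %3^ k + val x k) %3^ k       ≡⟨ Mod3^.[m%d+n]%d≡[m+n]%d k (3 ^ n ∸ val x n) _ ⟩
        (3 ^ n ∸ val x n + val x k) %3^ k               ≡⟨ cong (λ z → (3 ^ n ∸ val x n + z) %3^ k) (val-mod x i<n) ⟨
        (3 ^ n ∸ val x n + val x n %3^ k) %3^ k         ≡⟨ Mod3^.[m+n%d]%d≡[m+n]%d k (3 ^ n ∸ val x n) (val x n) ⟩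
        (3 ^ n ∸ val x n + val x n) %3^ k               ≡⟨ cong (_%3^ k) (m∸n+n≡m (<⇒≤ (val<3^n x n))) ⟩
        3 ^ n %3^ k                                     ≡⟨ n∣m⇒m%n≡0 (3 ^ n) (3 ^ k) {{3^n≢0 k}} (3^m∣3^n (≤⇒≤′ i<n)) ⟩
        0                                               ∎

  val-0 : ∀ n → val 0₃ n ≡ 0
  val-0 zero    = refl
  val-0 (suc n) = trans (+-identityʳ (val 0₃ n)) (val-0 n)

  val-1 : ∀ n → val 1₃ (suc n) ≡ 1
  val-1 zero    = refl
  val-1 (suc n) = trans (+-identityʳ (val 1₃ (suc n))) (val-1 n)

  val%3^n : ∀ x n → val x n %3^ n ≡ val x n
  val%3^n x n = m<n⇒m%n≡m {{3^n≢0 n}} (val<3^n x n)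

  +₃-cong : ∀ {x x′ y y′} → x ≈ x′ → y ≈ y′ → x +₃ y ≈ x′ +₃ y′
  +₃-cong x≈x′ y≈y′ i = cong₂ (λ p q → digit (p + q) i) (val-cong x≈x′ (suc i)) (val-cong y≈y′ (suc i))

  *₃-cong : ∀ {x x′ y y′} → x ≈ x′ → y ≈ y′ → x *₃ y ≈ x′ *₃ y′
  *₃-cong x≈x′ y≈y′ i = cong₂ (λ p q → digit (p * q) i) (val-cong x≈x′ (suc i)) (val-cong y≈y′ (suc i))

  -₃-cong : ∀ {x x′} → x ≈ x′ → -₃ x ≈ -₃ x′
  -₃-cong x≈x′ i = cong (λ p → digit (3 ^ suc i ∸ p) i) (val-cong x≈x′ (suc i))

  +₃-comm : ∀ x y → x +₃ y ≈ y +₃ x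
  +₃-comm x y = val-injective λ n → begin
    val (x +₃ y) n             ≡⟨ val-+ x y n ⟩
    (val x n + val y n) %3^ n  ≡⟨ cong (_%3^ n) (+-comm (val x n) _) ⟩
    (val y n + val x n) %3^ n  ≡⟨ val-+ y x n ⟨
    val (y +₃ x) n             ∎

  *₃-comm : ∀ x y → x *₃ y ≈ y *₃ x
  *₃-comm x y = val-injective λ n → begin
    val (x *₃ y) n             ≡⟨ val-* x y n ⟩
    (val x n * val y n) %3^ n  ≡⟨ cong (_%3^ n) (*-comm (val x n) _) ⟩
    (val y n * val x n) %3^ n  ≡⟨ val-* y x n ⟨
    val (y *₃ x) n             ∎

  +₃-assoc : ∀ x y z → (x +₃ y) +₃ z ≈ x +₃ (y +₃ z)
  +₃-assoc x y z = val-injective λ n → let open Mod3^ n; X = val x n; Y = val y n; Z = val z n in begin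
    val ((x +₃ y) +₃ z) n              ≡⟨ val-+ (x +₃ y) z n ⟩
    (val (x +₃ y) n + Z) %3^ n         ≡⟨ cong (λ w → (w + Z) %3^ n) (val-+ x y n) ⟩
    ((X + Y) %3^ n + Z) %3^ n          ≡⟨ [m%d+n]%d≡[m+n]%d (X + Y) Z ⟩
    (X + Y + Z) %3^ n                  ≡⟨ cong (_%3^ n) (+-assoc X Y Z) ⟩
    (X + (Y + Z)) %3^ n                ≡⟨ [m+n%d]%d≡[m+n]%d X (Y + Z) ⟨
    (X + (Y + Z) %3^ n) %3^ n          ≡⟨ cong (λ w → (X + w) %3^ n) (val-+ y z n) ⟨
    (X + val (y +₃ z) n) %3^ n         ≡⟨ val-+ x (y +₃ z) n ⟨
    val (x +₃ (y +₃ z)) n              ∎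

  *₃-assoc : ∀ x y z → (x *₃ y) *₃ z ≈ x *₃ (y *₃ z)
  *₃-assoc x y z = val-injective λ n → let open Mod3^ n; X = val x n; Y = val y n; Z = val z n in begin
    val ((x *₃ y) *₃ z) n              ≡⟨ val-* (x *₃ y) z n ⟩
    (val (x *₃ y) n * Z) %3^ n         ≡⟨ cong (λ w → (w * Z) %3^ n) (val-* x y n) ⟩
    ((X * Y) %3^ n * Z) %3^ n          ≡⟨ [m%d*n]%d≡[m*n]%d (X * Y) Z ⟩
    (X * Y * Z) %3^ n                  ≡⟨ cong (_%3^ n) (*-assoc X Y Z) ⟩
    (X * (Y * Z)) %3^ n                ≡⟨ [m*n%d]%d≡[m*n]%d X (Y * Z) ⟨
    (X * ((Y * Z) %3^ n)) %3^ n        ≡⟨ cong (λ w → (X * w) %3^ n) (val-* y z n) ⟨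
    (X * val (y *₃ z) n) %3^ n         ≡⟨ val-* x (y *₃ z) n ⟨
    val (x *₃ (y *₃ z)) n              ∎

  *₃-distribˡ-+₃ : ∀ x y z → x *₃ (y +₃ z) ≈ x *₃ y +₃ x *₃ z
  *₃-distribˡ-+₃ x y z = val-injective λ n → let open Mod3^ n; X = val x n; Y = val y n; Z = val z n in begin
    val (x *₃ (y +₃ z)) n                          ≡⟨ val-* x (y +₃ z) n ⟩
    (X * val (y +₃ z) n) %3^ n                     ≡⟨ cong (λ w → (X * w) %3^ n) (val-+ y z n) ⟩
    (X * ((Y + Z) %3^ n)) %3^ n                    ≡⟨ [m*n%d]%d≡[m*n]%d X (Y + Z) ⟩
    (X * (Y + Z)) %3^ n                            ≡⟨ cong (_%3^ n) (*-distribˡ-+ X Y Z) ⟩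
    (X * Y + X * Z) %3^ n                          ≡⟨ [m%d+n]%d≡[m+n]%d (X * Y) (X * Z) ⟨
    ((X * Y) %3^ n + X * Z) %3^ n                  ≡⟨ [m+n%d]%d≡[m+n]%d ((X * Y) %3^ n) (X * Z) ⟨
    ((X * Y) %3^ n + (X * Z) %3^ n) %3^ n          ≡⟨ cong₂ (λ p q → (p + q) %3^ n) (val-* x y n) (val-* x z n) ⟨
    (val (x *₃ y) n + val (x *₃ z) n) %3^ n        ≡⟨ val-+ (x *₃ y) (x *₃ z) n ⟨
    val (x *₃ y +₃ x *₃ z) n                       ∎

  +₃-identityˡ : ∀ x → 0₃ +₃ x ≈ x
  +₃-identityˡ x = val-injective λ n → begin
    val (0₃ +₃ x) n              ≡⟨ val-+ 0₃ x n ⟩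
    (val 0₃ n + val x n) %3^ n   ≡⟨ cong (λ w → (w + val x n) %3^ n) (val-0 n) ⟩
    val x n %3^ n                ≡⟨ val%3^n x n ⟩
    val x n                      ∎

  *₃-identityˡ : ∀ x → 1₃ *₃ x ≈ x
  *₃-identityˡ x = val-injective λ where
    zero    → refl
    (suc n) → begin
      val (1₃ *₃ x) (suc n)                  ≡⟨ val-* 1₃ x (suc n) ⟩
      (val 1₃ (suc n) * val x (suc n)) %3^ suc n ≡⟨ cong (λ w → (w * val x (suc n)) %3^ suc n) (val-1 n) ⟩
      (1 * val x (suc n)) %3^ suc n          ≡⟨ cong (_%3^ suc n) (*-identityˡ (val x (suc n))) ⟩
      val x (suc n) %3^ suc n                ≡⟨ val%3^n x (suc n) ⟩
      val x (suc n)                          ∎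

  -₃-inverseʳ : ∀ x → x +₃ (-₃ x) ≈ 0₃
  -₃-inverseʳ x = val-injective λ n → let open Mod3^ n in begin
    val (x +₃ (-₃ x)) n                          ≡⟨ val-+ x (-₃ x) n ⟩
    (val x n + val (-₃ x) n) %3^ n               ≡⟨ cong (λ w → (val x n + w) %3^ n) (val-neg x n) ⟩
    (val x n + (3 ^ n ∸ val x n) %3^ n) %3^ n    ≡⟨ [m+n%d]%d≡[m+n]%d (val x n) _ ⟩
    (val x n + (3 ^ n ∸ val x n)) %3^ n          ≡⟨ cong (_%3^ n) (m+[n∸m]≡n (<⇒≤ (val<3^n x n))) ⟩
    3 ^ n %3^ n                                  ≡⟨ n%n≡0 (3 ^ n) {{3^n≢0 n}} ⟩
    0                                            ≡⟨ val-0 n ⟨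
    val 0₃ n                                     ∎

  open import Algebra.Structures using (IsCommutativeRing)

  private
    ≈-trans : ∀ {x y z} → x ≈ y → y ≈ z → x ≈ z
    ≈-trans x≈y y≈z i = trans (x≈y i) (y≈z i)

  ℤ₃-isCommutativeRing : IsCommutativeRing _≈_ _+₃_ _*₃_ -₃_ 0₃ 1₃
  ℤ₃-isCommutativeRing = record
    { isRing = record
      { +-isAbelianGroup = record
        { isGroup = record
          { isMonoid = record
            { isSemigroup = record
              { isMagma = record
                { isEquivalence = record { refl = λ _ → refl ; sym = λ e i → sym (e i) ; trans = ≈-trans }
                ; ∙-cong = +₃-cong }
              ; assoc = +₃-assoc }
            ; identity = +₃-identityˡ , λ x → ≈-trans (+₃-comm x 0₃) (+₃-identityˡ x) }
          ; inverse = (λ x → ≈-trans (+₃-comm (-₃ x) x) (-₃-inverseʳ x)) , -₃-inverseʳ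
          ; ⁻¹-cong = -₃-cong }
        ; comm = +₃-comm }
      ; *-cong = *₃-cong
      ; *-assoc = *₃-assoc
      ; *-identity = *₃-identityˡ , λ x → ≈-trans (*₃-comm x 1₃) (*₃-identityˡ x)
      ; distrib = *₃-distribˡ-+₃ , λ x y z → ≈-trans (*₃-comm (y +₃ z) x)
                    (≈-trans (*₃-distribˡ-+₃ x y z) (+₃-cong (*₃-comm x y) (*₃-comm x z))) }
    ; *-comm = *₃-comm }

  ℤ₃-commutativeRing : CommutativeRing _ _
  ℤ₃-commutativeRing = record { isCommutativeRing = ℤ₃-isCommutativeRing }

open ℤ₃Ring using (ℤ₃-commutativeRing)

module ℤ₃Solver where
  open import Data.Integer as ℤ using (ℤ; +_; -[1+_]; _⊖_; _◃_)
  import Data.Integer.Properties as ℤₚ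
  import Data.Sign as Sign
  open import Data.Maybe using (Maybe; just; nothing)
  open import Data.Vec using (Vec; allFin; map)
  open import Data.Vec.N-ary using (N-ary; _$ⁿ_; Eq; Eqʰ; curryⁿ; curryⁿ-cong; curryⁿ-cong⁻¹; Eqʰ-to-Eq)
  open import Relation.Nullary using (yes; no)
  open import Algebra.Solver.Ring.AlmostCommutativeRing
  open CommutativeRing ℤ₃-commutativeRing
    using (semiring; ring; +-abelianGroup; setoid; +-identityˡ; +-identityʳ; +-assoc;
           +-comm; -‿inverseʳ; -‿cong; +-cong; *-cong)
    renaming (refl to ≈-refl; sym to ≈-sym; trans to ≈-trans)
  open import Algebra.Properties.Semiring.Mult.TCOptimised semiring using (×-homo-+; ×1-homo-*; 1+×) renaming (_×_ to _×′_)
  open import Algebra.Properties.Ring ring using (-‿distribˡ-*; -‿distribʳ-*)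
  open import Algebra.Properties.AbelianGroup +-abelianGroup using (⁻¹-∙-comm; ⁻¹-involutive; ε⁻¹≈ε)
  open import Relation.Binary.Reasoning.Setoid setoid

  -- with the optimised multiple _×′_, fromℤ (+ 0) and fromℤ (+ 1) are 0₃ and 1₃
  -- definitionally, so evaluated polynomials are literally the terms they denote
  fromℤ : ℤ → ℤ₃
  fromℤ (+ n)    = n ×′ 1₃
  fromℤ -[1+ n ] = -₃ (suc n ×′ 1₃)

  private
    fromℤ-⊖ : ∀ m n → fromℤ (m ⊖ n) ≈ m ×′ 1₃ -₃ n ×′ 1₃
    fromℤ-⊖ zero    zero    = ≈-sym (-‿inverseʳ 0₃)
    fromℤ-⊖ (suc m) zero    = ≈-sym (≈-trans (+-cong ≈-refl ε⁻¹≈ε) (+-identityʳ _))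
    fromℤ-⊖ zero    (suc n) = ≈-sym (+-identityˡ _)
    fromℤ-⊖ (suc m) (suc n) = begin
      fromℤ (suc m ⊖ suc n)                      ≡⟨ cong fromℤ (ℤₚ.[1+m]⊖[1+n]≡m⊖n m n) ⟩
      fromℤ (m ⊖ n)                              ≈⟨ fromℤ-⊖ m n ⟩
      m ×′ 1₃ -₃ n ×′ 1₃                         ≈⟨ +-identityˡ _ ⟨
      0₃ +₃ (m ×′ 1₃ -₃ n ×′ 1₃)                 ≈⟨ +-cong (-‿inverseʳ 1₃) ≈-refl ⟨
      (1₃ -₃ 1₃) +₃ (m ×′ 1₃ -₃ n ×′ 1₃)         ≈⟨ middle-four 1₃ (-₃ 1₃) (m ×′ 1₃) (-₃ (n ×′ 1₃)) ⟩
      (1₃ +₃ m ×′ 1₃) +₃ ((-₃ 1₃) -₃ n ×′ 1₃)    ≈⟨ +-cong (≈-sym (1+× m 1₃))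
                                                     (≈-trans (⁻¹-∙-comm 1₃ (n ×′ 1₃)) (-‿cong (≈-sym (1+× n 1₃)))) ⟩
      suc m ×′ 1₃ -₃ suc n ×′ 1₃                 ∎
      where
      middle-four : ∀ p q r s → (p +₃ q) +₃ (r +₃ s) ≈ (p +₃ r) +₃ (q +₃ s)
      middle-four p q r s = begin
        (p +₃ q) +₃ (r +₃ s)  ≈⟨ +-assoc p q _ ⟩
        p +₃ (q +₃ (r +₃ s))  ≈⟨ +-cong ≈-refl (+-assoc q r s) ⟨
        p +₃ ((q +₃ r) +₃ s)  ≈⟨ +-cong ≈-refl (+-cong (+-comm q r) ≈-refl) ⟩
        p +₃ ((r +₃ q) +₃ s)  ≈⟨ +-cong ≈-refl (+-assoc r q s) ⟩
        p +₃ (r +₃ (q +₃ s))  ≈⟨ +-assoc p r _ ⟨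
        (p +₃ r) +₃ (q +₃ s)  ∎

    fromℤ-+ : ∀ i j → fromℤ (i ℤ.+ j) ≈ fromℤ i +₃ fromℤ j
    fromℤ-+ (+ m)    (+ n)    = ×-homo-+ 1₃ m n
    fromℤ-+ (+ m)    -[1+ n ] = fromℤ-⊖ m (suc n)
    fromℤ-+ -[1+ m ] (+ n)    = ≈-trans (fromℤ-⊖ n (suc m)) (+-comm (n ×′ 1₃) _)
    fromℤ-+ -[1+ m ] -[1+ n ] = begin
      -₃ (suc (suc (m + n)) ×′ 1₃)          ≡⟨ cong (λ k → -₃ (suc k ×′ 1₃)) (ℕₚ.+-suc m n) ⟨
      -₃ ((suc m + suc n) ×′ 1₃)            ≈⟨ -‿cong (×-homo-+ 1₃ (suc m) (suc n)) ⟩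
      -₃ (suc m ×′ 1₃ +₃ suc n ×′ 1₃)       ≈⟨ ⁻¹-∙-comm _ _ ⟨
      -₃ (suc m ×′ 1₃) +₃ -₃ (suc n ×′ 1₃)  ∎

    fromℤ-neg : ∀ i → fromℤ (ℤ.- i) ≈ -₃ fromℤ i
    fromℤ-neg (+ zero)  = ≈-sym ε⁻¹≈ε
    fromℤ-neg (+ suc n) = ≈-refl
    fromℤ-neg -[1+ n ]  = ≈-sym (⁻¹-involutive _)

    fromℤ-◃-pos : ∀ n → fromℤ (Sign.+ ◃ n) ≈ n ×′ 1₃
    fromℤ-◃-pos zero    = ≈-refl
    fromℤ-◃-pos (suc n) = ≈-refl

    fromℤ-◃-neg : ∀ n → fromℤ (Sign.- ◃ n) ≈ -₃ (n ×′ 1₃)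
    fromℤ-◃-neg zero    = ≈-sym ε⁻¹≈ε
    fromℤ-◃-neg (suc n) = ≈-refl

    fromℤ-* : ∀ i j → fromℤ (i ℤ.* j) ≈ fromℤ i *₃ fromℤ j
    fromℤ-* (+ m)    (+ n)    = ≈-trans (fromℤ-◃-pos (m * n)) (×1-homo-* m n)
    fromℤ-* (+ m)    -[1+ n ] = ≈-trans (fromℤ-◃-neg (m * suc n))
      (≈-trans (-‿cong (×1-homo-* m (suc n))) (-‿distribʳ-* _ _))
    fromℤ-* -[1+ m ] (+ n)    = ≈-trans (fromℤ-◃-neg (suc m * n))
      (≈-trans (-‿cong (×1-homo-* (suc m) n)) (-‿distribˡ-* _ _))
    fromℤ-* -[1+ m ] -[1+ n ] = begin
      fromℤ (Sign.+ ◃ (suc m * suc n))             ≈⟨ fromℤ-◃-pos (suc m * suc n) ⟩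
      (suc m * suc n) ×′ 1₃                        ≈⟨ ×1-homo-* (suc m) (suc n) ⟩
      (suc m ×′ 1₃) *₃ (suc n ×′ 1₃)               ≈⟨ *-cong (⁻¹-involutive _) ≈-refl ⟨
      (-₃ (-₃ (suc m ×′ 1₃))) *₃ (suc n ×′ 1₃)     ≈⟨ -‿distribˡ-* _ _ ⟨
      -₃ ((-₃ (suc m ×′ 1₃)) *₃ (suc n ×′ 1₃))     ≈⟨ -‿distribʳ-* _ _ ⟩
      (-₃ (suc m ×′ 1₃)) *₃ (-₃ (suc n ×′ 1₃))     ∎

  fromℤ-morphism : ℤ.+-*-rawRing -Raw-AlmostCommutative⟶ fromCommutativeRing ℤ₃-commutativeRing
  fromℤ-morphism = record
    { ⟦_⟧ = fromℤ ; +-homo = fromℤ-+ ; *-homo = fromℤ-* ; -‿homo = fromℤ-neg ; 0-homo = ≈-refl ; 1-homo = ≈-refl }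

  private
    fromℤ-≟ : ∀ i j → Maybe (fromℤ i ≈ fromℤ j)
    fromℤ-≟ i j with i ℤ.≟ j
    ... | yes refl = just ≈-refl
    ... | no  _    = nothing

  open import Algebra.Solver.Ring ℤ.+-*-rawRing (fromCommutativeRing ℤ₃-commutativeRing) fromℤ-morphism fromℤ-≟
    public using (Polynomial; con; var; _:+_; _:*_; _:-_; :-_; _:=_; solve; prove; ⟦_⟧; ⟦_⟧↓)

  0ᴾ 1ᴾ : ∀ {n} → Polynomial n
  0ᴾ = con (+ 0)
  1ᴾ = con (+ 1)

  record PolyMat (n : ℕ) : Set where
    constructor pmat
    field
      pa pb pc pd : Polynomial n

  infixl 7 _⊛_
  _⊛_ : ∀ {n} → PolyMat n → PolyMat n → PolyMat n
  pmat a b c d ⊛ pmat a′ b′ c′ d′ =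
    pmat (a :* a′ :+ b :* c′) (a :* b′ :+ b :* d′) (c :* a′ :+ d :* c′) (c :* b′ :+ d :* d′)

  ⟦_⟧ᴹ ⟦_⟧ᴹ↓ : ∀ {n} → PolyMat n → Vec ℤ₃ n → Mat
  ⟦ pmat a b c d ⟧ᴹ  ρ = mat (⟦ a ⟧ ρ) (⟦ b ⟧ ρ) (⟦ c ⟧ ρ) (⟦ d ⟧ ρ)
  ⟦ pmat a b c d ⟧ᴹ↓ ρ = mat (⟦ a ⟧↓ ρ) (⟦ b ⟧↓ ρ) (⟦ c ⟧↓ ρ) (⟦ d ⟧↓ ρ)

  infix 4 _:=ᴹ_
  _:=ᴹ_ : ∀ {n} → PolyMat n → PolyMat n → PolyMat n × PolyMat n
  _:=ᴹ_ = _,_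

  solveᴹ : ∀ n (f : N-ary n (Polynomial n) (PolyMat n × PolyMat n)) →
    let P , Q = f $ⁿ map var (allFin n) in
    Eqʰ n _≈M_ (curryⁿ ⟦ P ⟧ᴹ↓) (curryⁿ ⟦ Q ⟧ᴹ↓) → Eq n _≈M_ (curryⁿ ⟦ P ⟧ᴹ) (curryⁿ ⟦ Q ⟧ᴹ)
  solveᴹ n f hyp with f $ⁿ map var (allFin n)
  ... | pmat a b c d , pmat a′ b′ c′ d′ = curryⁿ-cong _≈M_ _ _ λ ρ →
    let ha , hb , hc , hd = curryⁿ-cong⁻¹ _≈M_ _ _ (Eqʰ-to-Eq n _≈M_ hyp) ρ in
    prove ρ a a′ ha , prove ρ b b′ hb , prove ρ c c′ hc , prove ρ d d′ hd

open ℤ₃Solver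
open CommutativeRing ℤ₃-commutativeRing using (zeroʳ; +-identityʳ; -‿inverseʳ)
  renaming (refl to ≈-refl; sym to ≈-sym; trans to ≈-trans; setoid to ℤ₃-setoid;
            +-cong to +₃-cong; *-cong to *₃-cong; -‿cong to -₃-cong;
            *-identityˡ to *₃-identityˡ; *-identityʳ to *₃-identityʳ)

IsUnit-cong : ∀ {x y} → x ≈ y → IsUnit x → IsUnit y
IsUnit-cong x≈y (x⁻¹ , xx⁻¹≈1) = x⁻¹ , ≈-trans (*₃-cong (≈-sym x≈y) ≈-refl) xx⁻¹≈1

module ≈-Reasoning = Relation.Binary.Reasoning.Setoid ℤ₃-setoid

*₃-inverse-unique : ∀ {x x′ y} → x *₃ y ≈ 1₃ → x′ *₃ y ≈ 1₃ → x ≈ x′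
*₃-inverse-unique {x} {x′} {y} xy≈1 x′y≈1 = begin
  x                 ≈⟨ *₃-identityʳ x ⟨
  x *₃ 1₃           ≈⟨ *₃-cong ≈-refl x′y≈1 ⟨
  x *₃ (x′ *₃ y)    ≈⟨ solve 3 (λ x x′ y → x :* (x′ :* y) := x′ :* (x :* y)) ≈-refl x x′ y ⟩
  x′ *₃ (x *₃ y)    ≈⟨ *₃-cong ≈-refl xy≈1 ⟩
  x′ *₃ 1₃          ≈⟨ *₃-identityʳ x′ ⟩
  x′                ∎
  where open ≈-Reasoning

≈-mod-vanishing : ∀ {x y e} p → x ≈ y +₃ p *₃ e → e ≈ 0₃ → x ≈ y
≈-mod-vanishing {y = y} p x≈y+pe e≈0 = ≈-trans x≈y+pe
  (≈-trans (+₃-cong ≈-refl (≈-trans (*₃-cong ≈-refl e≈0) (zeroʳ p))) (+-identityʳ y))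

≈1⇒-1≈0 : ∀ {x} → x ≈ 1₃ → x -₃ 1₃ ≈ 0₃
≈1⇒-1≈0 x≈1 = ≈-trans (+₃-cong x≈1 ≈-refl) (-‿inverseʳ 1₃)

≈M-refl : ∀ {M} → M ≈M M
≈M-refl = ≈-refl , ≈-refl , ≈-refl , ≈-refl

≈M-sym : ∀ {M N} → M ≈M N → N ≈M M
≈M-sym (p , q , r , s) = ≈-sym p , ≈-sym q , ≈-sym r , ≈-sym s

≈M-trans : ∀ {M N P} → M ≈M N → N ≈M P → M ≈M P
≈M-trans (p , q , r , s) (p′ , q′ , r′ , s′) = ≈-trans p p′ , ≈-trans q q′ , ≈-trans r r′ , ≈-trans s s′

Mat-setoid : Setoid _ _
Mat-setoid = record
  { Carrier = Mat ; _≈_ = _≈M_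
  ; isEquivalence = record { refl = ≈M-refl ; sym = ≈M-sym ; trans = ≈M-trans } }

module ≈M-Reasoning = Relation.Binary.Reasoning.Setoid Mat-setoid

·-cong : ∀ {M M′ N N′} → M ≈M M′ → N ≈M N′ → M · N ≈M M′ · N′
·-cong (p , q , r , s) (p′ , q′ , r′ , s′) =
  +₃-cong (*₃-cong p p′) (*₃-cong q r′) , +₃-cong (*₃-cong p q′) (*₃-cong q s′) ,
  +₃-cong (*₃-cong r p′) (*₃-cong s r′) , +₃-cong (*₃-cong r q′) (*₃-cong s s′)

·-assoc : ∀ M N P → (M · N) · P ≈M M · (N · P)
·-assoc (mat a b c d) (mat a′ b′ c′ d′) (mat a″ b″ c″ d″) =
  entry a b a′ b′ c′ d′ a″ c″ , entry a b a′ b′ c′ d′ b″ d″ ,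
  entry c d a′ b′ c′ d′ a″ c″ , entry c d a′ b′ c′ d′ b″ d″
  where
  entry : ∀ x y a′ b′ c′ d′ z w →
    (x *₃ a′ +₃ y *₃ c′) *₃ z +₃ (x *₃ b′ +₃ y *₃ d′) *₃ w ≈ x *₃ (a′ *₃ z +₃ b′ *₃ w) +₃ y *₃ (c′ *₃ z +₃ d′ *₃ w)
  entry = solve 8 (λ x y a′ b′ c′ d′ z w →
    (x :* a′ :+ y :* c′) :* z :+ (x :* b′ :+ y :* d′) :* w := x :* (a′ :* z :+ b′ :* w) :+ y :* (c′ :* z :+ d′ :* w))
    ≈-refl

·-identityˡ : ∀ M → I₂ · M ≈M M
·-identityˡ (mat a b c d) = solveᴹ 4 (λ a b c d → pmat 1ᴾ 0ᴾ 0ᴾ 1ᴾ ⊛ pmat a b c d :=ᴹ pmat a b c d) ≈M-refl a b c d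

·-identityʳ : ∀ M → M · I₂ ≈M M
·-identityʳ (mat a b c d) = solveᴹ 4 (λ a b c d → pmat a b c d ⊛ pmat 1ᴾ 0ᴾ 0ᴾ 1ᴾ :=ᴹ pmat a b c d) ≈M-refl a b c d

det-cong : ∀ {M N} → M ≈M N → det M ≈ det N
det-cong (p , q , r , s) = +₃-cong (*₃-cong p s) (-₃-cong (*₃-cong q r))

det-· : ∀ M N → det (M · N) ≈ det M *₃ det N
det-· (mat a b c d) (mat a′ b′ c′ d′) = solve 8 (λ a b c d a′ b′ c′ d′ →
  (a :* a′ :+ b :* c′) :* (c :* b′ :+ d :* d′) :- (a :* b′ :+ b :* d′) :* (c :* a′ :+ d :* c′)
  := (a :* d :- b :* c) :* (a′ :* d′ :- b′ :* c′)) ≈-refl a b c d a′ b′ c′ d′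

det-I₂ : det I₂ ≈ 1₃
det-I₂ = solve 0 (1ᴾ :* 1ᴾ :- 0ᴾ :* 0ᴾ := 1ᴾ) ≈-refl

IsSL₂⇒IsGL₂ : ∀ {g} → IsSL₂ g → IsGL₂ g
IsSL₂⇒IsGL₂ det≈1 = 1₃ , ≈-trans (*₃-cong det≈1 ≈-refl) (*₃-identityˡ 1₃)

det-inverse : ∀ {g h} → h InverseOf g → det h *₃ det g ≈ 1₃
det-inverse {g} {h} (_ , hg≈I) = ≈-trans (≈-sym (det-· h g)) (≈-trans (det-cong hg≈I) det-I₂)

InverseOf⇒IsGL₂ : ∀ {g h} → h InverseOf g → IsGL₂ h
InverseOf⇒IsGL₂ {g} h-inverse = det g , det-inverse h-inverse

scalar : ℤ₃ → Mat
scalar s = mat s 0₃ 0₃ s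

adjugate : Mat → Mat
adjugate (mat a b c d) = mat d (-₃ b) (-₃ c) a

infixr 8 _⋆_
_⋆_ : ℤ₃ → Mat → Mat
s ⋆ mat a b c d = mat (s *₃ a) (s *₃ b) (s *₃ c) (s *₃ d)

·-⋆adjugate : ∀ M s → M · (s ⋆ adjugate M) ≈M scalar (det M *₃ s)
·-⋆adjugate (mat a b c d) = solveᴹ 5 (λ a b c d s →
  pmat a b c d ⊛ pmat (s :* d) (s :* :- b) (s :* :- c) (s :* a)
  :=ᴹ pmat ((a :* d :- b :* c) :* s) 0ᴾ 0ᴾ ((a :* d :- b :* c) :* s)) ≈M-refl a b c d

⋆adjugate-· : ∀ M s → (s ⋆ adjugate M) · M ≈M scalar (det M *₃ s)
⋆adjugate-· (mat a b c d) = solveᴹ 5 (λ a b c d s →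
  pmat (s :* d) (s :* :- b) (s :* :- c) (s :* a) ⊛ pmat a b c d
  :=ᴹ pmat ((a :* d :- b :* c) :* s) 0ᴾ 0ᴾ ((a :* d :- b :* c) :* s)) ≈M-refl a b c d

inverse : ∀ g → IsGL₂ g → Σ Mat (_InverseOf g)
inverse g (s , det·s≈1) = s ⋆ adjugate g ,
  ≈M-trans (·-⋆adjugate g s) (det·s≈1 , ≈-refl , ≈-refl , det·s≈1) ,
  ≈M-trans (⋆adjugate-· g s) (det·s≈1 , ≈-refl , ≈-refl , det·s≈1)

·-cancelʳ : ∀ {k k⁻¹} M → k⁻¹ InverseOf k → (M · k) · k⁻¹ ≈M M
·-cancelʳ {k} {k⁻¹} M (kk⁻¹≈I , _) = begin
  (M · k) · k⁻¹  ≈⟨ ·-assoc M k k⁻¹ ⟩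
  M · (k · k⁻¹)  ≈⟨ ·-cong ≈M-refl kk⁻¹≈I ⟩
  M · I₂         ≈⟨ ·-identityʳ M ⟩
  M              ∎
  where open ≈M-Reasoning

·-cancelˡ : ∀ {k k⁻¹} M → k⁻¹ InverseOf k → k⁻¹ · (k · M) ≈M M
·-cancelˡ {k} {k⁻¹} M (_ , k⁻¹k≈I) = begin
  k⁻¹ · (k · M)  ≈⟨ ·-assoc k⁻¹ k M ⟨
  (k⁻¹ · k) · M  ≈⟨ ·-cong k⁻¹k≈I ≈M-refl ⟩
  I₂ · M         ≈⟨ ·-identityˡ M ⟩
  M              ∎
  where open ≈M-Reasoning

infixl 6 _⊕_
infixl 7 _⊗_
_⊕_ _⊗_ : Fin 3 → Fin 3 → Fin 3
p ⊕ q = (toℕ p + toℕ q) mod 3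
p ⊗ q = (toℕ p * toℕ q) mod 3

⊖_ : Fin 3 → Fin 3
⊖ p = (3 ∸ toℕ p) mod 3

residue : ℤ₃ → Fin 3
residue x = x 0

module Residue where
  open ℕₚ using (*-identityʳ)
  open import Data.Nat.DivMod using (n/1≡n)
  open ≡ using (sym; trans)

  digit-zero : ∀ m → digit m 0 ≡ m mod 3
  digit-zero m = cong (_mod 3) (n/1≡n m)

  val-one : ∀ x → val x 1 ≡ toℕ (residue x)
  val-one x = *-identityʳ (toℕ (x 0))

  residue-+ : ∀ x y → residue (x +₃ y) ≡ residue x ⊕ residue y
  residue-+ x y = trans (digit-zero (val x 1 + val y 1)) (cong₂ (λ m n → (m + n) mod 3) (val-one x) (val-one y))

  residue-* : ∀ x y → residue (x *₃ y) ≡ residue x ⊗ residue y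
  residue-* x y = trans (digit-zero (val x 1 * val y 1)) (cong₂ (λ m n → (m * n) mod 3) (val-one x) (val-one y))

  residue-neg : ∀ x → residue (-₃ x) ≡ ⊖ residue x
  residue-neg x = trans (digit-zero (3 ∸ val x 1)) (cong (λ m → (3 ∸ m) mod 3) (val-one x))

  residue-det : ∀ a b c d → residue (det (mat a b c d)) ≡ residue a ⊗ residue d ⊕ ⊖ (residue b ⊗ residue c)
  residue-det a b c d = trans (residue-+ (a *₃ d) (-₃ (b *₃ c))) (cong₂ _⊕_ (residue-* a d)
    (trans (residue-neg (b *₃ c)) (cong ⊖_ (residue-* b c))))
open Residue using (residue-+; residue-neg; residue-det)

digit-equation-solvable : ∀ t a g → ¬ a ≡ 0F → ∃ λ k → t ⊕ a ⊗ k ≡ g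
digit-equation-solvable = toWitness {a? = all? λ t → all? λ a → all? λ g →
  ¬? (a Finₚ.≟ 0F) →-dec any? λ k → t ⊕ a ⊗ k Finₚ.≟ g} _

module UnitCriterion where
  open ℕₚ using (*-distribˡ-+; *-assoc)
  open import Data.Nat.DivMod using (%-distribˡ-+; +-distrib-/-∣ʳ; m*n/n≡m)
  open import Data.Nat.Divisibility using (n∣m*n)
  open ≡ using (sym; trans)
  open ≡.≡-Reasoning

  toℕ-mod : ∀ m → toℕ (m mod 3) ≡ m % 3
  toℕ-mod m = Finₚ.toℕ-fromℕ< _

  digit-+-multiple : ∀ m j i → digit (m + j * 3 ^ i) i ≡ digit m i ⊕ j mod 3
  digit-+-multiple m j i = Finₚ.toℕ-injective (begin
    toℕ (digit (m + j * 3 ^ i) i)                ≡⟨ toℕ-mod ((m + j * 3 ^ i) /3^ i) ⟩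
    (m + j * 3 ^ i) /3^ i % 3                    ≡⟨ cong (_% 3) shift ⟩
    (m /3^ i + j) % 3                            ≡⟨ %-distribˡ-+ (m /3^ i) j 3 ⟩
    (m /3^ i % 3 + j % 3) % 3                    ≡⟨ cong₂ (λ p q → (p + q) % 3) (toℕ-mod (m /3^ i)) (toℕ-mod j) ⟨
    (toℕ (digit m i) + toℕ (j mod 3)) % 3        ≡⟨ toℕ-mod (toℕ (digit m i) + toℕ (j mod 3)) ⟨
    toℕ (digit m i ⊕ j mod 3)                    ∎)
    where
    shift : (m + j * 3 ^ i) /3^ i ≡ m /3^ i + j
    shift = trans (+-distrib-/-∣ʳ m {{3^n≢0 i}} (n∣m*n j)) (cong (m /3^ i +_) (m*n/n≡m j (3 ^ i) {{3^n≢0 i}}))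

  -- x⁻¹ is built digit by digit: digit i is chosen so that digit i of
  -- x * x⁻¹ comes out right, which only depends on the digits chosen so far
  module _ (x : ℤ₃) (x≢0 : ¬ residue x ≡ 0F) where
    next-digit : ℕ → ℕ → Fin 3
    next-digit i p = proj₁ (digit-equation-solvable (digit (val x (suc i) * p) i) (residue x) (1₃ i) x≢0)

    partial : ℕ → ℕ
    partial zero    = 0
    partial (suc i) = partial i + toℕ (next-digit i (partial i)) * 3 ^ i

    x⁻¹ : ℤ₃
    x⁻¹ i = next-digit i (partial i)

    val-x⁻¹ : ∀ n → val x⁻¹ n ≡ partial n
    val-x⁻¹ zero    = refl
    val-x⁻¹ (suc n) = cong (_+ toℕ (x⁻¹ n) * 3 ^ n) (val-x⁻¹ n)

    x*x⁻¹≈1 : x *₃ x⁻¹ ≈ 1₃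
    x*x⁻¹≈1 i = begin
      digit (X * val x⁻¹ (suc i)) i           ≡⟨ cong (λ p → digit (X * p) i) (val-x⁻¹ (suc i)) ⟩
      digit (X * (P + k * 3 ^ i)) i           ≡⟨ cong (λ p → digit p i) distrib ⟩
      digit (X * P + X * k * 3 ^ i) i         ≡⟨ digit-+-multiple (X * P) (X * k) i ⟩
      digit (X * P) i ⊕ (X * k) mod 3         ≡⟨ cong (digit (X * P) i ⊕_) X*k≡x₀*k ⟩
      digit (X * P) i ⊕ residue x ⊗ x⁻¹ i     ≡⟨ proj₂ (digit-equation-solvable (digit (X * P) i) (residue x) (1₃ i) x≢0) ⟩
      1₃ i                                    ∎
      where
      X P k : ℕ
      X = val x (suc i)
      P = partial i
      k = toℕ (x⁻¹ i)
      distrib : X * (P + k * 3 ^ i) ≡ X * P + X * k * 3 ^ i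
      distrib = trans (*-distribˡ-+ X P (k * 3 ^ i)) (cong (X * P +_) (sym (*-assoc X k (3 ^ i))))
      X*k≡x₀*k : (X * k) mod 3 ≡ residue x ⊗ x⁻¹ i
      X*k≡x₀*k = Finₚ.toℕ-injective (begin
        toℕ ((X * k) mod 3)          ≡⟨ toℕ-mod (X * k) ⟩
        (X * k) % 3                  ≡⟨ Mod3^.[m%d*n]%d≡[m*n]%d 1 X k ⟨
        (X % 3 * k) % 3              ≡⟨ cong (λ p → (p * k) % 3) (trans (ℤ₃Ring.val-mod x {1} {suc i} (s≤s z≤n)) (Residue.val-one x)) ⟩
        (toℕ (residue x) * k) % 3    ≡⟨ toℕ-mod (toℕ (residue x) * k) ⟨
        toℕ (residue x ⊗ x⁻¹ i)      ∎)

unit-criterion : ∀ x → ¬ residue x ≡ 0F → IsUnit x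
unit-criterion x x≢0 = UnitCriterion.x⁻¹ x x≢0 , UnitCriterion.x*x⁻¹≈1 x x≢0

-- -1 is not a square modulo 3, so a matrix of determinant -1 that is
-- diagonal modulo 3 has distinct diagonal residues
det≡-1⇒diagonal-distinct : ∀ p q r s → q ≡ 0F → r ≡ 0F → p ⊗ s ⊕ ⊖ (q ⊗ r) ≡ 2F → ¬ (p ⊕ r) ⊕ ⊖ (q ⊕ s) ≡ 0F
det≡-1⇒diagonal-distinct = toWitness {a? = all? λ p → all? λ q → all? λ r → all? λ s →
  q Finₚ.≟ 0F →-dec r Finₚ.≟ 0F →-dec p ⊗ s ⊕ ⊖ (q ⊗ r) Finₚ.≟ 2F →-dec ¬? ((p ⊕ r) ⊕ ⊖ (q ⊕ s) Finₚ.≟ 0F)} _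

det≡1⇒first-column-nonzero : ∀ p q r s → r ≡ 0F → p ⊗ s ⊕ ⊖ (q ⊗ r) ≡ 1F → ¬ p ⊕ r ≡ 0F
det≡1⇒first-column-nonzero = toWitness {a? = all? λ p → all? λ q → all? λ r → all? λ s →
  r Finₚ.≟ 0F →-dec p ⊗ s ⊕ ⊖ (q ⊗ r) Finₚ.≟ 1F →-dec ¬? (p ⊕ r Finₚ.≟ 0F)} _

nonzero⊎pred-nonzero : ∀ p → ¬ p ≡ 0F ⊎ ¬ p ⊕ ⊖ 1F ≡ 0F
nonzero⊎pred-nonzero = toWitness {a? = all? λ p → ¬? (p Finₚ.≟ 0F) ⊎-dec ¬? (p ⊕ ⊖ 1F Finₚ.≟ 0F)} _

IsUnit⊎pred-IsUnit : ∀ t → IsUnit t ⊎ IsUnit (t -₃ 1₃)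
IsUnit⊎pred-IsUnit t =
  [ inj₁ ∘ unit-criterion t , (λ t-1≢0 → inj₂ (unit-criterion (t -₃ 1₃) (t-1≢0 ∘ ≡.trans (≡.sym residue-t-1)))) ]′
  (nonzero⊎pred-nonzero (residue t))
  where
  residue-t-1 : residue (t -₃ 1₃) ≡ residue t ⊕ ⊖ 1F
  residue-t-1 = ≡.trans (residue-+ t (-₃ 1₃)) (cong (residue t ⊕_) (residue-neg 1₃))

det≈1⇒a+c-IsUnit : ∀ a b c d → det (mat a b c d) ≈ 1₃ → residue c ≡ 0F → IsUnit (a +₃ c)
det≈1⇒a+c-IsUnit a b c d det≈1 c≡0 = unit-criterion (a +₃ c) λ a+c≡0 →
  det≡1⇒first-column-nonzero (residue a) (residue b) (residue c) (residue d) c≡0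
    (≡.trans (≡.sym (residue-det a b c d)) (det≈1 0)) (≡.trans (≡.sym (residue-+ a c)) a+c≡0)

det≈-1⇒a+c-b-d-IsUnit : ∀ a b c d → det (mat a b c d) ≈ -₃ 1₃ → residue b ≡ 0F → residue c ≡ 0F →
                         IsUnit ((a +₃ c) -₃ (b +₃ d))
det≈-1⇒a+c-b-d-IsUnit a b c d det≈-1 b≡0 c≡0 = unit-criterion ((a +₃ c) -₃ (b +₃ d)) λ e≡0 →
  det≡-1⇒diagonal-distinct (residue a) (residue b) (residue c) (residue d) b≡0 c≡0
    (≡.trans (≡.sym (residue-det a b c d)) (det≈-1 0)) (≡.trans (≡.sym residue-e) e≡0)
  where
  residue-e : residue ((a +₃ c) -₃ (b +₃ d)) ≡ (residue a ⊕ residue c) ⊕ ⊖ (residue b ⊕ residue d)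
  residue-e = ≡.trans (residue-+ (a +₃ c) (-₃ (b +₃ d))) (cong₂ _⊕_ (residue-+ a c)
    (≡.trans (residue-neg (b +₃ d)) (cong ⊖_ (residue-+ b d))))

E F D : ℤ₃ → Mat
E x = mat 1₃ x 0₃ 1₃
F x = mat 1₃ 0₃ x 1₃
D u = mat u 0₃ 0₃ 1₃

Eᴾ Fᴾ Dᴾ : ∀ {n} → Polynomial n → PolyMat n
Eᴾ x = pmat 1ᴾ x 0ᴾ 1ᴾ
Fᴾ x = pmat 1ᴾ 0ᴾ x 1ᴾ
Dᴾ u = pmat u 0ᴾ 0ᴾ 1ᴾ

-- the companion matrix of X² - τ X + δ
companion : ℤ₃ → ℤ₃ → Mat
companion τ δ = mat 0₃ (-₃ δ) 1₃ τ

companionᴾ : ∀ {n} → Polynomial n → Polynomial n → PolyMat n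
companionᴾ τ δ = pmat 0ᴾ (:- δ) 1ᴾ τ

trace : Mat → ℤ₃
trace M = a M +₃ d M

swap : Mat
swap = mat 0₃ 1₃ 1₃ 0₃

weyl : Mat
weyl = E 1₃ · F (-₃ 1₃) · E 1₃

E-cong : ∀ {x y} → x ≈ y → E x ≈M E y
E-cong x≈y = ≈-refl , x≈y , ≈-refl , ≈-refl

E-+ : ∀ x y → E x · E y ≈M E (x +₃ y)
E-+ = solveᴹ 2 (λ x y → Eᴾ x ⊛ Eᴾ y :=ᴹ Eᴾ (x :+ y)) ≈M-refl

F-cancel : ∀ x M → F (-₃ x) · (F x · M) ≈M M
F-cancel x (mat a b c d) = solveᴹ 5 (λ x a b c d → Fᴾ (:- x) ⊛ (Fᴾ x ⊛ pmat a b c d) :=ᴹ pmat a b c d) ≈M-refl x a b c d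

D-E : ∀ u x → D u · E x ≈M E (u *₃ x) · D u
D-E = solveᴹ 2 (λ u x → Dᴾ u ⊛ Eᴾ x :=ᴹ Eᴾ (u :* x) ⊛ Dᴾ u) ≈M-refl

D-F : ∀ u x → D u · F (x *₃ u) ≈M F x · D u
D-F = solveᴹ 2 (λ u x → Dᴾ u ⊛ Fᴾ (x :* u) :=ᴹ Fᴾ x ⊛ Dᴾ u) ≈M-refl

companion-E : ∀ τ x → companion τ (-₃ 1₃) · E x ≈M F x · companion τ (-₃ 1₃)
companion-E = solveᴹ 2 (λ τ x → companionᴾ τ (:- 1ᴾ) ⊛ Eᴾ x :=ᴹ Fᴾ x ⊛ companionᴾ τ (:- 1ᴾ)) ≈M-refl

-- Cayley–Hamilton for the basis (e₁ , M e₁)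
cayley-hamilton : ∀ M → M · mat 1₃ (a M) 0₃ (c M) ≈M mat 1₃ (a M) 0₃ (c M) · companion (trace M) (det M)
cayley-hamilton (mat a b c d) = solveᴹ 4 (λ a b c d →
  pmat a b c d ⊛ pmat 1ᴾ a 0ᴾ c :=ᴹ pmat 1ᴾ a 0ᴾ c ⊛ companionᴾ (a :+ d) (a :* d :- b :* c)) ≈M-refl a b c d

swap-conjugate : ∀ M → swap · M ≈M mat (d M) (c M) (b M) (a M) · swap
swap-conjugate (mat a b c d) = solveᴹ 4 (λ a b c d →
  pmat 0ᴾ 1ᴾ 1ᴾ 0ᴾ ⊛ pmat a b c d :=ᴹ pmat d c b a ⊛ pmat 0ᴾ 1ᴾ 1ᴾ 0ᴾ) ≈M-refl a b c d

F-conjugate : ∀ M → F 1₃ · M ≈M mat (a M -₃ b M) (b M) ((a M +₃ c M) -₃ (b M +₃ d M)) (b M +₃ d M) · F 1₃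
F-conjugate (mat a b c d) = solveᴹ 4 (λ a b c d →
  Fᴾ 1ᴾ ⊛ pmat a b c d :=ᴹ pmat (a :- b) b ((a :+ c) :- (b :+ d)) (b :+ d) ⊛ Fᴾ 1ᴾ) ≈M-refl a b c d

weyl⁴≈I₂ : (weyl · weyl) · (weyl · weyl) ≈M I₂
weyl⁴≈I₂ = solveᴹ 0 ((w ⊛ w) ⊛ (w ⊛ w) :=ᴹ pmat 1ᴾ 0ᴾ 0ᴾ 1ᴾ) ≈M-refl
  where
  w : PolyMat 0
  w = Eᴾ 1ᴾ ⊛ Fᴾ (:- 1ᴾ) ⊛ Eᴾ 1ᴾ

E-F-E : ∀ α γ β → E α · F γ · E β ≈M mat (1₃ +₃ α *₃ γ) ((1₃ +₃ α *₃ γ) *₃ β +₃ α) γ (γ *₃ β +₃ 1₃)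
E-F-E = solveᴹ 3 (λ α γ β →
  Eᴾ α ⊛ Fᴾ γ ⊛ Eᴾ β :=ᴹ pmat (1ᴾ :+ α :* γ) ((1ᴾ :+ α :* γ) :* β :+ α) γ (γ :* β :+ 1ᴾ)) ≈M-refl

det-E : ∀ x → det (E x) ≈ 1₃
det-E = solve 1 (λ x → 1ᴾ :* 1ᴾ :- x :* 0ᴾ := 1ᴾ) ≈-refl

det-F : ∀ x → det (F x) ≈ 1₃
det-F = solve 1 (λ x → 1ᴾ :* 1ᴾ :- 0ᴾ :* x := 1ᴾ) ≈-refl

det-D : ∀ u → det (D u) ≈ u
det-D = solve 1 (λ u → u :* 1ᴾ :- 0ᴾ :* 0ᴾ := u) ≈-refl

det-swap : det swap ≈ -₃ 1₃
det-swap = solve 0 (0ᴾ :* 0ᴾ :- 1ᴾ :* 1ᴾ := :- 1ᴾ) ≈-refl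

det-basis : ∀ a c → det (mat 1₃ a 0₃ c) ≈ c
det-basis = solve 2 (λ a c → 1ᴾ :* c :- a :* 0ᴾ := c) ≈-refl

det-swapped : ∀ M → det (mat (d M) (c M) (b M) (a M)) ≈ det M
det-swapped (mat a b c d) = solve 4 (λ a b c d → d :* a :- c :* b := a :* d :- b :* c) ≈-refl a b c d

det-F-conjugated : ∀ M → det (mat (a M -₃ b M) (b M) ((a M +₃ c M) -₃ (b M +₃ d M)) (b M +₃ d M)) ≈ det M
det-F-conjugated (mat a b c d) = solve 4 (λ a b c d →
  (a :- b) :* (b :+ d) :- b :* ((a :+ c) :- (b :+ d)) := a :* d :- b :* c) ≈-refl a b c d

E-IsGL₂ : ∀ x → IsGL₂ (E x)
E-IsGL₂ x = IsSL₂⇒IsGL₂ (det-E x)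

F-IsGL₂ : ∀ x → IsGL₂ (F x)
F-IsGL₂ x = IsSL₂⇒IsGL₂ (det-F x)

two : ℤ₃
two = 1₃ +₃ 1₃

two-IsUnit : IsUnit two
two-IsUnit = unit-criterion two λ ()

D-IsGL₂ : ∀ {u} → IsUnit u → IsGL₂ (D u)
D-IsGL₂ {u} = IsUnit-cong (≈-sym (det-D u))

swap-IsGL₂ : IsGL₂ swap
swap-IsGL₂ = IsUnit-cong (≈-sym det-swap) (-₃ 1₃ , solve 0 (:- 1ᴾ :* :- 1ᴾ := 1ᴾ) ≈-refl)

E-F-E-factorisation : ∀ a b c d c⁻¹ → c *₃ c⁻¹ ≈ 1₃ → det (mat a b c d) ≈ 1₃ →
                      E ((a -₃ 1₃) *₃ c⁻¹) · F c · E ((d -₃ 1₃) *₃ c⁻¹) ≈M mat a b c d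
E-F-E-factorisation a b c d c⁻¹ cc⁻¹≈1 det≈1 = ≈M-trans (E-F-E ((a -₃ 1₃) *₃ c⁻¹) c ((d -₃ 1₃) *₃ c⁻¹))
  ( ≈-mod-vanishing (a -₃ 1₃) (entry-a a c c⁻¹) cc⁻¹-1≈0
  , ≈-mod-vanishing c⁻¹ (≈-mod-vanishing (b +₃ (a -₃ 1₃) *₃ (d -₃ 1₃) *₃ c⁻¹) (entry-b a b c d c⁻¹) cc⁻¹-1≈0)
                    (≈1⇒-1≈0 det≈1)
  , ≈-refl
  , ≈-mod-vanishing (d -₃ 1₃) (entry-d c d c⁻¹) cc⁻¹-1≈0 )
  where
  cc⁻¹-1≈0 : c *₃ c⁻¹ -₃ 1₃ ≈ 0₃
  cc⁻¹-1≈0 = ≈1⇒-1≈0 cc⁻¹≈1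
  entry-a : ∀ a c c⁻¹ → 1₃ +₃ (a -₃ 1₃) *₃ c⁻¹ *₃ c ≈ a +₃ (a -₃ 1₃) *₃ (c *₃ c⁻¹ -₃ 1₃)
  entry-a = solve 3 (λ a c c⁻¹ → 1ᴾ :+ (a :- 1ᴾ) :* c⁻¹ :* c := a :+ (a :- 1ᴾ) :* (c :* c⁻¹ :- 1ᴾ)) ≈-refl
  entry-b : ∀ a b c d c⁻¹ →
    (1₃ +₃ (a -₃ 1₃) *₃ c⁻¹ *₃ c) *₃ ((d -₃ 1₃) *₃ c⁻¹) +₃ (a -₃ 1₃) *₃ c⁻¹
    ≈ b +₃ c⁻¹ *₃ (a *₃ d -₃ b *₃ c -₃ 1₃) +₃ (b +₃ (a -₃ 1₃) *₃ (d -₃ 1₃) *₃ c⁻¹) *₃ (c *₃ c⁻¹ -₃ 1₃)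
  entry-b = solve 5 (λ a b c d c⁻¹ →
    (1ᴾ :+ (a :- 1ᴾ) :* c⁻¹ :* c) :* ((d :- 1ᴾ) :* c⁻¹) :+ (a :- 1ᴾ) :* c⁻¹
    := b :+ c⁻¹ :* (a :* d :- b :* c :- 1ᴾ) :+ (b :+ (a :- 1ᴾ) :* (d :- 1ᴾ) :* c⁻¹) :* (c :* c⁻¹ :- 1ᴾ)) ≈-refl
  entry-d : ∀ c d c⁻¹ → c *₃ ((d -₃ 1₃) *₃ c⁻¹) +₃ 1₃ ≈ d +₃ (d -₃ 1₃) *₃ (c *₃ c⁻¹ -₃ 1₃)
  entry-d = solve 3 (λ c d c⁻¹ → c :* ((d :- 1ᴾ) :* c⁻¹) :+ 1ᴾ := d :+ (d :- 1ᴾ) :* (c :* c⁻¹ :- 1ᴾ)) ≈-refl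

module ModuloNormalSubgroup {N : Mat → Set} (N-normal : IsNormalSubgroup N) where
  open IsNormalSubgroup N-normal
  open IsSubgroup subgroup
  open ≈M-Reasoning

  infix 4 _~_
  _~_ : Mat → Mat → Set
  g ~ h = Σ Mat λ n → N n × (g ≈M n · h)

  N-inverse : ∀ {n} → N n → Σ Mat λ m → N m × m InverseOf n
  N-inverse Nn = let m , m-inverse = inverse _ (⊆GL₂ Nn) in m , inv Nn m-inverse , m-inverse

  ~-respˡ : ∀ {g g′ h} → g ≈M g′ → g ~ h → g′ ~ h
  ~-respˡ g≈g′ (n , Nn , g≈nh) = n , Nn , ≈M-trans (≈M-sym g≈g′) g≈nh

  ~-respʳ : ∀ {g h h′} → h ≈M h′ → g ~ h → g ~ h′
  ~-respʳ h≈h′ (n , Nn , g≈nh) = n , Nn , ≈M-trans g≈nh (·-cong ≈M-refl h≈h′)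

  ~-trans : ∀ {g h k} → g ~ h → h ~ k → g ~ k
  ~-trans {k = k} (n , Nn , g≈nh) (m , Nm , h≈mk) =
    n · m , mul Nn Nm , ≈M-trans g≈nh (≈M-trans (·-cong ≈M-refl h≈mk) (≈M-sym (·-assoc n m k)))

  ~-sym : ∀ {g h} → g ~ h → h ~ g
  ~-sym {g} {h} (n , Nn , g≈nh) = let m , Nm , m-inverse = N-inverse Nn in
    m , Nm , ≈M-sym (≈M-trans (·-cong ≈M-refl g≈nh) (·-cancelˡ h m-inverse))

  N⇒~I₂ : ∀ {n} → N n → n ~ I₂
  N⇒~I₂ {n} Nn = n , Nn , ≈M-sym (·-identityʳ n)

  ~I₂⇒N : ∀ {g} → g ~ I₂ → N g
  ~I₂⇒N (n , Nn , g≈nI) = respects (≈M-sym (≈M-trans g≈nI (·-identityʳ n))) Nn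

  ~-·ʳ : ∀ {g h} k → g ~ h → g · k ~ h · k
  ~-·ʳ {h = h} k (n , Nn , g≈nh) = n , Nn , ≈M-trans (·-cong g≈nh ≈M-refl) (·-assoc n h k)

  ~-·ˡ : ∀ {g h k} → IsGL₂ k → g ~ h → k · g ~ k · h
  ~-·ˡ {g} {h} {k} k∈GL₂ (n , Nn , g≈nh) = let k⁻¹ , k⁻¹-inverse = inverse k k∈GL₂ in
    k · n · k⁻¹ , conj k∈GL₂ k⁻¹-inverse Nn , (begin
      k · g                      ≈⟨ ·-cong ≈M-refl g≈nh ⟩
      k · (n · h)                ≈⟨ ·-assoc k n h ⟨
      (k · n) · h                ≈⟨ ·-cong ≈M-refl (·-cancelˡ h k⁻¹-inverse) ⟨
      (k · n) · (k⁻¹ · (k · h))  ≈⟨ ·-assoc (k · n) k⁻¹ (k · h) ⟨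
      k · n · k⁻¹ · (k · h)      ∎)

  ~-· : ∀ {g g′ h h′} → IsGL₂ g′ → g ~ g′ → h ~ h′ → g · h ~ g′ · h′
  ~-· {h = h} g′∈GL₂ g~g′ h~h′ = ~-trans (~-·ʳ h g~g′) (~-·ˡ g′∈GL₂ h~h′)

  N-conjugate : ∀ {P n m} → IsGL₂ P → P · n ≈M m · P → N n → N m
  N-conjugate {P} {n} {m} P∈GL₂ Pn≈mP Nn = let P⁻¹ , P⁻¹-inverse = inverse P P∈GL₂ in
    respects (begin
      P · n · P⁻¹    ≈⟨ ·-cong Pn≈mP ≈M-refl ⟩
      (m · P) · P⁻¹  ≈⟨ ·-cancelʳ m P⁻¹-inverse ⟩
      m              ∎) (conj P∈GL₂ P⁻¹-inverse Nn)

  N-conjugate⁻¹ : ∀ {P n m} → IsGL₂ P → n · P ≈M P · m → N n → N m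
  N-conjugate⁻¹ {P} {n} {m} P∈GL₂ nP≈Pm = let P⁻¹ , P⁻¹-inverse = inverse P P∈GL₂ in
    N-conjugate (InverseOf⇒IsGL₂ P⁻¹-inverse) (begin
      P⁻¹ · n              ≈⟨ ·-cancelʳ (P⁻¹ · n) P⁻¹-inverse ⟨
      (P⁻¹ · n) · P · P⁻¹  ≈⟨ ·-cong (·-assoc P⁻¹ n P) ≈M-refl ⟩
      P⁻¹ · (n · P) · P⁻¹  ≈⟨ ·-cong (·-cong ≈M-refl nP≈Pm) ≈M-refl ⟩
      P⁻¹ · (P · m) · P⁻¹  ≈⟨ ·-cong (·-cancelˡ m P⁻¹-inverse) ≈M-refl ⟩
      m · P⁻¹              ∎)

  ~-conjugate : ∀ {k g g′ h h′} → IsGL₂ k → k · g ≈M g′ · k → k · h ≈M h′ · k → g ~ h → g′ ~ h′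
  ~-conjugate {k} {g} {g′} {h} {h′} k∈GL₂ kg≈g′k kh≈h′k g~h = let k⁻¹ , k⁻¹-inverse = inverse k k∈GL₂ in
    ~-respˡ (≈M-trans (·-cong kg≈g′k ≈M-refl) (·-cancelʳ g′ k⁻¹-inverse))
      (~-respʳ (≈M-trans (·-cong kh≈h′k ≈M-refl) (·-cancelʳ h′ k⁻¹-inverse))
        (~-·ʳ k⁻¹ (~-·ˡ k∈GL₂ g~h)))

  ~-commute : ∀ {n g h} → N n → IsGL₂ h → n · g ≈M h · n → h ~ g
  ~-commute {n} {g} {h} Nn h∈GL₂ ng≈hn =
    ~-trans (~-respˡ (·-identityʳ h) (~-·ˡ h∈GL₂ (~-sym (N⇒~I₂ Nn))))
      (~-respˡ ng≈hn (~-respʳ (·-identityˡ g) (~-·ʳ g (N⇒~I₂ Nn))))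

module Generation {N : Mat → Set} (N-normal : IsNormalSubgroup N) where
  open IsNormalSubgroup N-normal
  open IsSubgroup subgroup
  open ModuloNormalSubgroup N-normal
  open import Relation.Nullary using (yes; no)

  ⟨SL₂∪N⟩-det : ∀ {g} → ⟨SL₂∪ N ⟩ g → Σ Mat λ n → N n × det n ≈ det g
  ⟨SL₂∪N⟩-det (gen-SL det≈1) = I₂ , has-I , ≈-trans det-I₂ (≈-sym det≈1)
  ⟨SL₂∪N⟩-det (gen-N Ng)     = _ , Ng , ≈-refl
  ⟨SL₂∪N⟩-det gen-I          = I₂ , has-I , ≈-refl
  ⟨SL₂∪N⟩-det (gen-mul {g} {h} g∈ h∈) =
    let n , Nn , detn≈detg = ⟨SL₂∪N⟩-det g∈
        m , Nm , detm≈deth = ⟨SL₂∪N⟩-det h∈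
    in n · m , mul Nn Nm , ≈-trans (det-· n m) (≈-trans (*₃-cong detn≈detg detm≈deth) (≈-sym (det-· g h)))
  ⟨SL₂∪N⟩-det (gen-inv g∈ h-inverse) =
    let n , Nn , detn≈detg = ⟨SL₂∪N⟩-det g∈
        m , Nm , m-inverse = N-inverse Nn
    in m , Nm , *₃-inverse-unique (≈-trans (*₃-cong ≈-refl (≈-sym detn≈detg)) (det-inverse m-inverse))
                                  (det-inverse h-inverse)
  ⟨SL₂∪N⟩-det (gen-resp g≈h g∈) =
    let n , Nn , detn≈detg = ⟨SL₂∪N⟩-det g∈ in n , Nn , ≈-trans detn≈detg (det-cong g≈h)

  ⟨SL₂∪N⟩⊆N : (∀ {s} → IsSL₂ s → N s) → ∀ {g} → ⟨SL₂∪ N ⟩ g → N g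
  ⟨SL₂∪N⟩⊆N SL₂⊆N (gen-SL s∈SL₂)       = SL₂⊆N s∈SL₂
  ⟨SL₂∪N⟩⊆N SL₂⊆N (gen-N Ng)           = Ng
  ⟨SL₂∪N⟩⊆N SL₂⊆N gen-I                = has-I
  ⟨SL₂∪N⟩⊆N SL₂⊆N (gen-mul g∈ h∈)      = mul (⟨SL₂∪N⟩⊆N SL₂⊆N g∈) (⟨SL₂∪N⟩⊆N SL₂⊆N h∈)
  ⟨SL₂∪N⟩⊆N SL₂⊆N (gen-inv g∈ h-inverse) = inv (⟨SL₂∪N⟩⊆N SL₂⊆N g∈) h-inverse
  ⟨SL₂∪N⟩⊆N SL₂⊆N (gen-resp g≈h g∈)    = respects g≈h (⟨SL₂∪N⟩⊆N SL₂⊆N g∈)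

  companion∈N : ∀ {n} → N n → IsUnit (c n) → N (companion (trace n) (det n))
  companion∈N {n} Nn c-unit =
    N-conjugate⁻¹ (IsUnit-cong (≈-sym (det-basis (a n) (c n))) c-unit) (cayley-hamilton n) Nn

  -- IsUnit (c m) says that e₁ is a cyclic vector of m
  cyclic-conjugate : ∀ {n} → N n → det n ≈ -₃ 1₃ → Σ Mat λ m → N m × IsUnit (c m) × det m ≈ -₃ 1₃
  cyclic-conjugate {n} Nn det≈-1 with residue (c n) Finₚ.≟ 0F | residue (b n) Finₚ.≟ 0F
  ... | no c≢0  | _       = n , Nn , unit-criterion (c n) c≢0 , det≈-1
  ... | yes _   | no b≢0  = _ , N-conjugate swap-IsGL₂ (swap-conjugate n) Nn , unit-criterion (b n) b≢0 ,
                            ≈-trans (det-swapped n) det≈-1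
  ... | yes c≡0 | yes b≡0 = _ , N-conjugate (F-IsGL₂ 1₃) (F-conjugate n) Nn ,
                            det≈-1⇒a+c-b-d-IsUnit (a n) (b n) (c n) (d n) det≈-1 b≡0 c≡0 ,
                            ≈-trans (det-F-conjugated n) det≈-1

  det≈-1⇒companion∈N : ∀ {n} → N n → det n ≈ -₃ 1₃ → Σ ℤ₃ λ τ → N (companion τ (-₃ 1₃))
  det≈-1⇒companion∈N Nn det≈-1 =
    let m , Nm , c-unit , detm≈-1 = cyclic-conjugate Nn det≈-1
    in trace m , respects (≈-refl , -₃-cong detm≈-1 , ≈-refl , ≈-refl) (companion∈N Nm c-unit)

  module _ {τ} (C∈N : N (companion τ (-₃ 1₃))) where

    F~E : ∀ x → F x ~ E x
    F~E x = ~-commute C∈N (F-IsGL₂ x) (companion-E τ x)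

    E~E[4x] : ∀ x → E x ~ E (two *₃ (x *₃ two))
    E~E[4x] x = ~-trans (~-sym (F~E x))
      (~-conjugate (D-IsGL₂ two-IsUnit) (D-F two x) (D-E two (x *₃ two)) (F~E (x *₃ two)))

    E[3x]∈N : ∀ x → N (E ((two +₃ 1₃) *₃ x))
    E[3x]∈N x = ~I₂⇒N (~-respˡ (≈M-trans (E-+ _ (-₃ x)) (E-cong (four-one x)))
                        (~-respʳ (≈M-trans (E-+ x (-₃ x)) (E-cong (-‿inverseʳ x)))
                          (~-·ʳ (E (-₃ x)) (~-sym (E~E[4x] x)))))
      where
      four-one : ∀ x → two *₃ (x *₃ two) -₃ x ≈ (two +₃ 1₃) *₃ x
      four-one = solve 1 (λ x → (1ᴾ :+ 1ᴾ) :* (x :* (1ᴾ :+ 1ᴾ)) :- x := (1ᴾ :+ 1ᴾ :+ 1ᴾ) :* x) ≈-refl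

    weyl~E1 : weyl ~ E 1₃
    weyl~E1 = ~-respʳ (≈M-trans (E-+ (1₃ +₃ -₃ 1₃) 1₃) (E-cong one))
      (~-respʳ (·-cong (E-+ 1₃ (-₃ 1₃)) ≈M-refl) (~-·ʳ (E 1₃) (~-·ˡ (E-IsGL₂ 1₃) (F~E (-₃ 1₃)))))
      where
      one : (1₃ +₃ -₃ 1₃) +₃ 1₃ ≈ 1₃
      one = solve 0 (1ᴾ :+ :- 1ᴾ :+ 1ᴾ := 1ᴾ) ≈-refl

    E4∈N : N (E (two +₃ two))
    E4∈N = ~I₂⇒N (~-sym (~-respˡ weyl⁴≈I₂ (~-respʳ (E-+ two two) (~-· (E-IsGL₂ two) weyl²~E2 weyl²~E2))))
      where
      weyl²~E2 : weyl · weyl ~ E two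
      weyl²~E2 = ~-respʳ (E-+ 1₃ 1₃) (~-· (E-IsGL₂ 1₃) weyl~E1 weyl~E1)

    E1∈N : N (E 1₃)
    E1∈N = respects (≈M-trans (E-+ (two +₃ two) _) (E-cong four-three)) (mul E4∈N (E[3x]∈N (-₃ 1₃)))
      where
      four-three : (two +₃ two) +₃ (two +₃ 1₃) *₃ (-₃ 1₃) ≈ 1₃
      four-three = solve 0 ((1ᴾ :+ 1ᴾ) :+ (1ᴾ :+ 1ᴾ) :+ (1ᴾ :+ 1ᴾ :+ 1ᴾ) :* (:- 1ᴾ) := 1ᴾ) ≈-refl

    E[unit]∈N : ∀ {u} → IsUnit u → N (E u)
    E[unit]∈N {u} u-unit = respects (E-cong (*₃-identityʳ u)) (N-conjugate (D-IsGL₂ u-unit) (D-E u 1₃) E1∈N)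

    E∈N : ∀ t → N (E t)
    E∈N t = [ E[unit]∈N , (λ t-1-unit → respects (≈M-trans (E-+ 1₃ (t -₃ 1₃)) (E-cong (one+[t-1] t)))
                                          (mul E1∈N (E[unit]∈N t-1-unit))) ]′ (IsUnit⊎pred-IsUnit t)
      where
      one+[t-1] : ∀ t → 1₃ +₃ (t -₃ 1₃) ≈ t
      one+[t-1] = solve 1 (λ t → 1ᴾ :+ (t :- 1ᴾ) := t) ≈-refl

    F∈N : ∀ t → N (F t)
    F∈N t = ~I₂⇒N (~-trans (F~E t) (N⇒~I₂ (E∈N t)))

    SL₂[unit]⊆N : ∀ {s} → IsSL₂ s → IsUnit (c s) → N s
    SL₂[unit]⊆N {mat a b c d} det≈1 (c⁻¹ , cc⁻¹≈1) =
      respects (E-F-E-factorisation a b c d c⁻¹ cc⁻¹≈1 det≈1) (mul (mul (E∈N _) (F∈N c)) (E∈N _))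

    SL₂⊆N : ∀ {s} → IsSL₂ s → N s
    SL₂⊆N {s@(mat a b c d)} det≈1 with residue c Finₚ.≟ 0F
    ... | no c≢0  = SL₂[unit]⊆N det≈1 (unit-criterion c c≢0)
    ... | yes c≡0 = respects (F-cancel 1₃ s) (mul (F∈N (-₃ 1₃)) (SL₂[unit]⊆N det[F1·s]≈1 c-unit))
      where
      det[F1·s]≈1 : det (F 1₃ · s) ≈ 1₃
      det[F1·s]≈1 = ≈-trans (det-· (F 1₃) s) (≈-trans (*₃-cong (det-F 1₃) det≈1) (*₃-identityˡ 1₃))
      c-unit : IsUnit (1₃ *₃ a +₃ 1₃ *₃ c)
      c-unit = IsUnit-cong (solve 2 (λ a c → a :+ c := 1ᴾ :* a :+ 1ᴾ :* c) ≈-refl a c)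
                           (det≈1⇒a+c-IsUnit a b c d det≈1 c≡0)

lemma4p11 : (N : Mat → Set) → IsNormalSubgroup N → IsClosed N
            → (∀ g → IsGL₂ g → ⟨SL₂∪ N ⟩ g)
            → ∀ g → IsGL₂ g → N g
lemma4p11 N N-normal _ generates g g∈GL₂ =
  let n , Nn , detn≈det-swap = ⟨SL₂∪N⟩-det (generates swap swap-IsGL₂)
      _ , C∈N = det≈-1⇒companion∈N Nn (≈-trans detn≈det-swap det-swap)
  in ⟨SL₂∪N⟩⊆N (SL₂⊆N C∈N) (generates g g∈GL₂)
  where open Generation N-normal
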